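{- Let $\mathcal{SP}$ be the class of split graphs. Then: (i) $R_{1}^{\mathcal{SP}}(4,5)=7$ and $R_{1}^{\mathcal{SP}}(4,6)=8$; (ii) $R_{2}^{\mathcal{SP}}(6,7)=11$ and $R_{2}^{\mathcal{SP}}(6,8)=12$; (iii) $R_{2}^{\mathcal{SP}}(5,6)=8$ and $R_{2}^{\mathcal{SP}}(5,7)=9$; (iv) $R_{2}^{\mathcal{SP}}(5,j)=j+3$ for all integers $8\leq j\leq 12$.
   Context: All graphs are finite and simple. A graph is split if its vertex set can be partitioned into a clique and an independent set. For a graph $G$ and an integer $k\ge 0$, a $k$-sparse $j$-set is a set of exactly $j$ vertices of $G$ inducing a subgraph of maximum degree at most $k$; a $k$-dense $i$-set is a set of exactly $i$ vertices that is $k$-sparse in the complement of $G$. For a graph class $\mathcal{G}$, $R_k^{\mathcal{G}}(i,j)$ is the smallest natural number $n$ such that every graph on $n$ vertices in $\mathcal{G}$ has a $k$-dense $i$-set or a $k$-sparse $j$-set. -}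

module Defs where

open import Data.Nat using (ℕ; _≤_)
open import Data.Bool using (Bool; true; false; not; if_then_else_)
open import Data.Fin using (Fin; _≟_)
open import Data.Fin.Subset using (Subset; _∈_; _∩_; ∁; ∣_∣)
open import Data.Vec using (tabulate)
open import Data.Product using (Σ; _×_; ∃)
open import Data.Sum using (_⊎_)
open import Relation.Binary.PropositionalEquality using (_≡_)
open import Relation.Nullary using (¬_; does)

record Graph (n : ℕ) : Set where
  field
    adj   : Fin n → Fin n → Bool
    sym   : ∀ u v → adj u v ≡ adj v u
    irrefl : ∀ v → adj v v ≡ false
open Graph public

complement : ∀ {n} → Graph n → Graph n
complement {n} G = record { adj = cadj ; sym = csym ; irrefl = cirr }
  where
  cadj : Fin n → Fin n → Bool
  cadj u v = if does (u ≟ v) then false else not (adj G u v)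
  csym : ∀ u v → cadj u v ≡ cadj v u
  csym u v with u ≟ v | v ≟ u
  ... | Relation.Nullary.yes _ | Relation.Nullary.yes _ = Relation.Binary.PropositionalEquality.refl
  ... | Relation.Nullary.yes p | Relation.Nullary.no q = Data.Empty.⊥-elim (q (Relation.Binary.PropositionalEquality.sym p))
    where import Data.Empty
  ... | Relation.Nullary.no p | Relation.Nullary.yes q = Data.Empty.⊥-elim (p (Relation.Binary.PropositionalEquality.sym q))
    where import Data.Empty
  ... | Relation.Nullary.no _ | Relation.Nullary.no _ = Relation.Binary.PropositionalEquality.cong not (sym G u v)
  cirr : ∀ v → cadj v v ≡ false
  cirr v with v ≟ v
  ... | Relation.Nullary.yes _ = Relation.Binary.PropositionalEquality.refl
  ... | Relation.Nullary.no p = Data.Empty.⊥-elim (p Relation.Binary.PropositionalEquality.refl)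
    where import Data.Empty

N : ∀ {n} → Graph n → Fin n → Subset n
N G v = tabulate (adj G v)

degIn : ∀ {n} → Graph n → Subset n → Fin n → ℕ
degIn G S v = ∣ S ∩ N G v ∣

MaxDegAtMost : ∀ {n} → Graph n → Subset n → ℕ → Set
MaxDegAtMost G S k = ∀ v → v ∈ S → degIn G S v ≤ k

SparseSet : ∀ {n} → Graph n → ℕ → ℕ → Subset n → Set
SparseSet G k j S = (∣ S ∣ ≡ j) × MaxDegAtMost G S k

DenseSet : ∀ {n} → Graph n → ℕ → ℕ → Subset n → Set
DenseSet G k i S = SparseSet (complement G) k i S

IsClique : ∀ {n} → Graph n → Subset n → Set
IsClique G S = ∀ u v → u ∈ S → v ∈ S → ¬ (u ≡ v) → adj G u v ≡ true

IsIndependent : ∀ {n} → Graph n → Subset n → Set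
IsIndependent G S = ∀ u v → u ∈ S → v ∈ S → adj G u v ≡ false

IsSplit : ∀ {n} → Graph n → Set
IsSplit G = Σ (Subset _) λ C → IsClique G C × IsIndependent G (∁ C)

SplitRamseyProp : ℕ → ℕ → ℕ → ℕ → Set
SplitRamseyProp k i j n =
  (G : Graph n) → IsSplit G →
  (∃ λ S → DenseSet G k i S) ⊎ (∃ λ S → SparseSet G k j S)

SplitRamseyIs : ℕ → ℕ → ℕ → ℕ → Set
SplitRamseyIs k i j r = SplitRamseyProp k i j r × (∀ m → SplitRamseyProp k i j m → r ≤ m)

module Submission where

-- A split graph with clique K (a vertices) and independent set I (b vertices) contains the
-- k-dense a-set K and the k-sparse b-set I.  A vertex of K with at most k neighbours in I
-- extends I to a k-sparse (b+1)-set, and two vertices of K with fewer than k neighbours in I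
-- extend it to a k-sparse (b+2)-set; dually, vertices of I with few non-neighbours in K extend
-- K in the complement.  If no extension of the required kind exists, counting the edges
-- between K and I once from each side contradicts the numerical hypothesis.  Each lower
-- bound is a split graph on one vertex fewer, checked by exhaustive search over its subsets.

open import Algebra.Properties.CommutativeSemigroup using (interchange)
open import Data.Bool using (Bool; true; false; not)
open import Data.Bool.ListAction using (any)
open import Data.Bool.Properties using (not-involutive)
open import Data.Empty using (⊥-elim)
open import Data.Fin using (Fin; zero; suc; _≟_; splitAt; #_)
open import Data.Fin.Properties using (suc-injective; any?; all?; splitAt⁻¹-↑ˡ)
open import Data.Fin.Subset
  using (Subset; inside; outside; _∈_; _∉_; _⊆_; _∩_; _∪_; ∁; ⁅_⁆; ∣_∣; Empty)
open import Data.Fin.Subset.Properties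
  using (_∈?_; anySubset?; x∈p∩q⁺; x∈p∩q⁻; x∈p∪q⁻; x∈⁅y⁆⇒x≡y; x∈p⇒x∉∁p; p∩q⊆p; ∩-distribʳ-∪;
         ∣⁅x⁆∣≡1; ∣⊥∣≡0; ∣p∣≤n; ∣∁p∣≡n∸∣p∣; ∣p∩q∣≤∣p∣; p⊆q⇒∣p∣≤∣q∣; p⊂q⇒∣p∣<∣q∣;
         Empty-unique; out⊆; in⊆in)
open import Data.List using (List; []; _∷_)
open import Data.Nat
  using (ℕ; zero; suc; _+_; _*_; _∸_; _≤_; _<_; _≤′_; ≤′-refl; ≤′-step; _≤?_; _<?_; z≤n; s≤s)
open import Data.Nat.Properties
  using (+-assoc; +-comm; +-suc; +-identityʳ; *-suc; *-zeroʳ; *-identityˡ; +-commutativeSemigroup;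
         +-mono-≤; +-monoʳ-≤; +-monoˡ-<; +-cancelˡ-≡; +-cancelʳ-≤; ≤-antisym; ≤-pred; ≤-reflexive;
         ≤-trans; <⇒≤; <⇒≱; ≰⇒>; ≮⇒≥; ≤⇒≤′; ≤ᵇ⇒≤; n≮n; m≤m+n; m+n≤o⇒m≤o; m+n≤o⇒m≤o∸n;
         m≤n+m∸n; m+[n∸m]≡n; m≤n⇒∃[o]m+o≡n; module ≤-Reasoning)
  renaming (_≟_ to _≟ℕ_)
open import Data.Product using (∃; _×_; _,_; proj₂; map₂)
open import Data.Sum using (_⊎_; inj₁; inj₂; swap; map₁; [_,_]′)
open import Data.Unit using (tt)
open import Data.Vec using (Vec; []; _∷_; lookup; tabulate; here; there)
open import Data.Vec.Properties using ([]=⇒lookup; lookup∘tabulate; lookup-map; tabulate-cong)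
open import Defs hiding (sym)
open import Function using (_∘_)
open import Relation.Binary.PropositionalEquality
  using (_≡_; _≢_; refl; sym; trans; cong; cong₂; subst; subst₂; module ≡-Reasoning)
open import Relation.Nullary using (¬_; does; yes; no; ¬?; contradiction; _×-dec_; _→-dec_)
open import Relation.Nullary.Decidable using (dec-true; dec-false; False; toWitnessFalse)
open import Relation.Unary using (Decidable)

private
  variable
    m n : ℕ

-- Sums over subsets

𝟙 : Bool → ℕ
𝟙 true  = 1
𝟙 false = 0

∑ : Subset n → (Fin n → ℕ) → ℕ
∑ []            f = 0
∑ (inside ∷ S)  f = f zero + ∑ S (f ∘ suc)
∑ (outside ∷ S) f = ∑ S (f ∘ suc)

∑-cong : ∀ (S : Subset n) {f g : Fin n → ℕ} → (∀ {x} → x ∈ S → f x ≡ g x) → ∑ S f ≡ ∑ S g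
∑-cong []            f≡g = refl
∑-cong (inside ∷ S)  f≡g = cong₂ _+_ (f≡g here) (∑-cong S (f≡g ∘ there))
∑-cong (outside ∷ S) f≡g = ∑-cong S (f≡g ∘ there)

∑-mono-≤ : ∀ (S : Subset n) {f g : Fin n → ℕ} → (∀ {x} → x ∈ S → f x ≤ g x) → ∑ S f ≤ ∑ S g
∑-mono-≤ []            f≤g = z≤n
∑-mono-≤ (inside ∷ S)  f≤g = +-mono-≤ (f≤g here) (∑-mono-≤ S (f≤g ∘ there))
∑-mono-≤ (outside ∷ S) f≤g = ∑-mono-≤ S (f≤g ∘ there)

∑-distrib-+ : ∀ (S : Subset n) (f g : Fin n → ℕ) → ∑ S (λ x → f x + g x) ≡ ∑ S f + ∑ S g
∑-distrib-+ []            f g = refl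
∑-distrib-+ (inside ∷ S)  f g =
  trans (cong (f zero + g zero +_) (∑-distrib-+ S (f ∘ suc) (g ∘ suc)))
        (interchange +-commutativeSemigroup (f zero) (g zero) _ _)
∑-distrib-+ (outside ∷ S) f g = ∑-distrib-+ S (f ∘ suc) (g ∘ suc)

∑-const : ∀ (S : Subset n) c → ∑ S (λ _ → c) ≡ c * ∣ S ∣
∑-const []            c = sym (*-zeroʳ c)
∑-const (inside ∷ S)  c = trans (cong (c +_) (∑-const S c)) (sym (*-suc c ∣ S ∣))
∑-const (outside ∷ S) c = ∑-const S c

∑-≤-const : ∀ (S : Subset n) {f c} → (∀ {x} → x ∈ S → f x ≤ c) → ∑ S f ≤ c * ∣ S ∣
∑-≤-const S {c = c} f≤c = ≤-trans (∑-mono-≤ S f≤c) (≤-reflexive (∑-const S c))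

const-≤-∑ : ∀ (S : Subset n) {f c} → (∀ {x} → x ∈ S → c ≤ f x) → c * ∣ S ∣ ≤ ∑ S f
const-≤-∑ S {c = c} c≤f = ≤-trans (≤-reflexive (sym (∑-const S c))) (∑-mono-≤ S c≤f)

∑-comm : (S : Subset m) (T : Subset n) (h : Fin m → Fin n → ℕ) →
         ∑ S (λ x → ∑ T (h x)) ≡ ∑ T (λ y → ∑ S (λ x → h x y))
∑-comm []            T h = sym (∑-const T 0)
∑-comm (inside ∷ S)  T h = trans (cong (∑ T (h zero) +_) (∑-comm S T (h ∘ suc)))
                                 (sym (∑-distrib-+ T (h zero) _))
∑-comm (outside ∷ S) T h = ∑-comm S T (h ∘ suc)

AtMostOneAbove : Subset n → (Fin n → ℕ) → ℕ → Set
AtMostOneAbove S f c = ∀ {x y} → x ∈ S → y ∈ S → x ≢ y → f x ≤ c ⊎ f y ≤ c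

atMostOneAbove-tail : ∀ {s} {S : Subset n} {f c} →
                      AtMostOneAbove (s ∷ S) f c → AtMostOneAbove S (f ∘ suc) c
atMostOneAbove-tail pair x∈S y∈S x≢y = pair (there x∈S) (there y∈S) (x≢y ∘ suc-injective)

∑-≤-but-one : (S : Subset n) {f : Fin n → ℕ} {c d : ℕ} →
              AtMostOneAbove S f c → (∀ {x} → x ∈ S → f x ≤ c + d) → ∑ S f ≤ c * ∣ S ∣ + d
∑-≤-but-one []            _    _     = z≤n
∑-≤-but-one (outside ∷ S) pair bound = ∑-≤-but-one S (atMostOneAbove-tail pair) (bound ∘ there)
∑-≤-but-one (inside ∷ S) {f} {c} {d} pair bound with f zero ≤? c
... | yes f₀≤c = begin
  f zero + ∑ S (f ∘ suc)  ≤⟨ +-mono-≤ f₀≤c rest≤ ⟩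
  c + (c * ∣ S ∣ + d)     ≡⟨ sym (+-assoc c _ d) ⟩
  c + c * ∣ S ∣ + d       ≡⟨ cong (_+ d) (sym (*-suc c ∣ S ∣)) ⟩
  c * suc ∣ S ∣ + d       ∎
  where
  open ≤-Reasoning
  rest≤ = ∑-≤-but-one S (atMostOneAbove-tail pair) (bound ∘ there)
... | no f₀≰c = begin
  f zero + ∑ S (f ∘ suc)  ≤⟨ +-mono-≤ (bound here) (∑-≤-const S rest≤c) ⟩
  c + d + c * ∣ S ∣       ≡⟨ +-assoc c d _ ⟩
  c + (d + c * ∣ S ∣)     ≡⟨ cong (c +_) (+-comm d _) ⟩
  c + (c * ∣ S ∣ + d)     ≡⟨ sym (+-assoc c _ d) ⟩
  c + c * ∣ S ∣ + d       ≡⟨ cong (_+ d) (sym (*-suc c ∣ S ∣)) ⟩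
  c * suc ∣ S ∣ + d       ∎
  where
  open ≤-Reasoning
  rest≤c : ∀ {x} → x ∈ S → f (suc x) ≤ c
  rest≤c x∈S with pair here (there x∈S) (λ ())
  ... | inj₁ f₀≤c = contradiction f₀≤c f₀≰c
  ... | inj₂ fx≤c = fx≤c

∣p∪q∣+∣p∩q∣≡∣p∣+∣q∣ : ∀ (p q : Subset n) → ∣ p ∪ q ∣ + ∣ p ∩ q ∣ ≡ ∣ p ∣ + ∣ q ∣
∣p∪q∣+∣p∩q∣≡∣p∣+∣q∣ []            []            = refl
∣p∪q∣+∣p∩q∣≡∣p∣+∣q∣ (inside ∷ p)  (inside ∷ q)  =
  cong suc (trans (+-suc _ _) (trans (cong suc (∣p∪q∣+∣p∩q∣≡∣p∣+∣q∣ p q)) (sym (+-suc _ _))))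
∣p∪q∣+∣p∩q∣≡∣p∣+∣q∣ (inside ∷ p)  (outside ∷ q) = cong suc (∣p∪q∣+∣p∩q∣≡∣p∣+∣q∣ p q)
∣p∪q∣+∣p∩q∣≡∣p∣+∣q∣ (outside ∷ p) (inside ∷ q)  =
  trans (cong suc (∣p∪q∣+∣p∩q∣≡∣p∣+∣q∣ p q)) (sym (+-suc _ _))
∣p∪q∣+∣p∩q∣≡∣p∣+∣q∣ (outside ∷ p) (outside ∷ q) = ∣p∪q∣+∣p∩q∣≡∣p∣+∣q∣ p q

∣p∪q∣≤∣p∣+∣q∣ : ∀ (p q : Subset n) → ∣ p ∪ q ∣ ≤ ∣ p ∣ + ∣ q ∣
∣p∪q∣≤∣p∣+∣q∣ p q = ≤-trans (m≤m+n _ _) (≤-reflexive (∣p∪q∣+∣p∩q∣≡∣p∣+∣q∣ p q))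

∣p∣+∣∁p∣≡n : ∀ (p : Subset n) → ∣ p ∣ + ∣ ∁ p ∣ ≡ n
∣p∣+∣∁p∣≡n p = trans (cong (∣ p ∣ +_) (∣∁p∣≡n∸∣p∣ p)) (m+[n∸m]≡n (∣p∣≤n p))

Empty⇒∣p∣≡0 : {p : Subset n} → Empty p → ∣ p ∣ ≡ 0
Empty⇒∣p∣≡0 {n} empty = trans (cong ∣_∣ (Empty-unique empty)) (∣⊥∣≡0 n)

∣p∪q∣≡∣p∣+∣q∣ : ∀ (p q : Subset n) → (∀ {x} → x ∈ p → x ∉ q) → ∣ p ∪ q ∣ ≡ ∣ p ∣ + ∣ q ∣
∣p∪q∣≡∣p∣+∣q∣ p q disjoint = begin
  ∣ p ∪ q ∣                ≡⟨ sym (+-identityʳ _) ⟩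
  ∣ p ∪ q ∣ + 0            ≡⟨ cong (∣ p ∪ q ∣ +_) (sym (Empty⇒∣p∣≡0 p∩q-empty)) ⟩
  ∣ p ∪ q ∣ + ∣ p ∩ q ∣    ≡⟨ ∣p∪q∣+∣p∩q∣≡∣p∣+∣q∣ p q ⟩
  ∣ p ∣ + ∣ q ∣            ∎
  where
  open ≡-Reasoning
  p∩q-empty : Empty (p ∩ q)
  p∩q-empty (x , x∈p∩q) = let x∈p , x∈q = x∈p∩q⁻ p q x∈p∩q in disjoint x∈p x∈q

⊆-ofSize : ∀ (S : Subset n) {m} → m ≤ ∣ S ∣ → ∃ λ T → T ⊆ S × ∣ T ∣ ≡ m
⊆-ofSize []            z≤n         = [] , (λ x∈T → x∈T) , refl
⊆-ofSize (outside ∷ S) m≤∣S∣       = let T , T⊆S , ∣T∣≡m = ⊆-ofSize S m≤∣S∣ in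
                                     outside ∷ T , out⊆ T⊆S , ∣T∣≡m
⊆-ofSize (inside ∷ S)  z≤n         = let T , T⊆S , ∣T∣≡0 = ⊆-ofSize S z≤n in
                                     outside ∷ T , out⊆ T⊆S , ∣T∣≡0
⊆-ofSize (inside ∷ S)  (s≤s m≤∣S∣) = let T , T⊆S , ∣T∣≡m = ⊆-ofSize S m≤∣S∣ in
                                     inside ∷ T , in⊆in T⊆S , cong suc ∣T∣≡m

∈-tabulate⁻ : ∀ {p : Fin n → Bool} {x} → x ∈ tabulate p → p x ≡ true
∈-tabulate⁻ {p = p} {x} x∈ = trans (sym (lookup∘tabulate p x)) ([]=⇒lookup x∈)

∈-∁-tabulate⁻ : ∀ {p : Fin n → Bool} {x} → x ∈ ∁ (tabulate p) → not (p x) ≡ true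
∈-∁-tabulate⁻ {p = p} {x} x∈ = begin
  not (p x)                       ≡⟨ cong not (lookup∘tabulate p x) ⟨
  not (lookup (tabulate p) x)     ≡⟨ lookup-map x not (tabulate p) ⟨
  lookup (∁ (tabulate p)) x       ≡⟨ []=⇒lookup x∈ ⟩
  true                            ∎
  where open ≡-Reasoning

degIn≡∑ : ∀ (G : Graph n) S v → degIn G S v ≡ ∑ S (𝟙 ∘ adj G v)
degIn≡∑ G S v = go S (adj G v)
  where
  go : ∀ {m} (S : Subset m) (p : Fin m → Bool) → ∣ S ∩ tabulate p ∣ ≡ ∑ S (𝟙 ∘ p)
  go []            p = refl
  go (outside ∷ S) p = go S (p ∘ suc)
  go (inside ∷ S)  p with p zero
  ... | true  = cong suc (go S (p ∘ suc))
  ... | false = go S (p ∘ suc)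

module _ (G : Graph n) where

  -- Both sides count the edges between S and T.
  ∑-degIn-comm : ∀ S T → ∑ S (degIn G T) ≡ ∑ T (degIn G S)
  ∑-degIn-comm S T = begin
    ∑ S (degIn G T)                          ≡⟨ ∑-cong S (λ {x} _ → degIn≡∑ G T x) ⟩
    ∑ S (λ x → ∑ T (λ y → 𝟙 (adj G x y)))    ≡⟨ ∑-comm S T _ ⟩
    ∑ T (λ y → ∑ S (λ x → 𝟙 (adj G x y)))
      ≡⟨ ∑-cong T (λ {y} _ → ∑-cong S (λ {x} _ → cong 𝟙 (Graph.sym G x y))) ⟩
    ∑ T (λ y → ∑ S (λ x → 𝟙 (adj G y x)))    ≡⟨ ∑-cong T (λ {y} _ → sym (degIn≡∑ G S y)) ⟩
    ∑ T (degIn G S)                          ∎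
    where open ≡-Reasoning

  degIn-mono-⊆ : ∀ {S T} → S ⊆ T → ∀ v → degIn G S v ≤ degIn G T v
  degIn-mono-⊆ {S} S⊆T v = p⊆q⇒∣p∣≤∣q∣ λ x∈ →
    let x∈S , x∈N = x∈p∩q⁻ S (N G v) x∈ in x∈p∩q⁺ (S⊆T x∈S , x∈N)

  degIn-∪ : ∀ S T v → degIn G (S ∪ T) v ≤ degIn G S v + degIn G T v
  degIn-∪ S T v = ≤-trans (≤-reflexive (cong ∣_∣ (∩-distribʳ-∪ (N G v) S T)))
                          (∣p∪q∣≤∣p∣+∣q∣ (S ∩ N G v) (T ∩ N G v))

  degIn-< : ∀ {S v} → v ∈ S → degIn G S v < ∣ S ∣
  degIn-< {S} {v} v∈S = p⊂q⇒∣p∣<∣q∣ (p∩q⊆p S (N G v) , v , v∈S , v∉S∩N)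
    where
    v∉S∩N : v ∉ S ∩ N G v
    v∉S∩N v∈ with () ← trans (sym (irrefl G v)) (∈-tabulate⁻ (proj₂ (x∈p∩q⁻ S (N G v) v∈)))

  degIn-independent : ∀ {J v} → IsIndependent G J → v ∈ J → degIn G J v ≡ 0
  degIn-independent {J} {v} independent v∈J = Empty⇒∣p∣≡0 λ (u , u∈) →
    let u∈J , u∈N = x∈p∩q⁻ J (N G v) u∈ in
    contradiction (trans (sym (independent v u v∈J u∈J)) (∈-tabulate⁻ u∈N)) λ ()

  degIn+degIn-complement : ∀ {S v} → v ∉ S → degIn G S v + degIn (complement G) S v ≡ ∣ S ∣
  degIn+degIn-complement {S} {v} v∉S = begin
    degIn G S v + degIn (complement G) S v
      ≡⟨ cong₂ _+_ (degIn≡∑ G S v) (degIn≡∑ (complement G) S v) ⟩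
    ∑ S (𝟙 ∘ adj G v) + ∑ S (𝟙 ∘ adj (complement G) v)
      ≡⟨ sym (∑-distrib-+ S _ _) ⟩
    ∑ S (λ u → 𝟙 (adj G v u) + 𝟙 (adj (complement G) v u))
      ≡⟨ ∑-cong S (λ u∈S → one-of (λ { refl → v∉S u∈S })) ⟩
    ∑ S (λ _ → 1)
      ≡⟨ trans (∑-const S 1) (*-identityˡ _) ⟩
    ∣ S ∣ ∎
    where
    open ≡-Reasoning
    one-of : ∀ {u} → v ≢ u → 𝟙 (adj G v u) + 𝟙 (adj (complement G) v u) ≡ 1
    one-of {u} v≢u rewrite dec-false (v ≟ u) v≢u with adj G v u
    ... | true  = refl
    ... | false = refl

  maxDeg-antimono-⊆ : ∀ {S T k} → S ⊆ T → MaxDegAtMost G T k → MaxDegAtMost G S k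
  maxDeg-antimono-⊆ S⊆T maxDeg v v∈S = ≤-trans (degIn-mono-⊆ S⊆T v) (maxDeg v (S⊆T v∈S))

  sparseSet-⊆ : ∀ {S k j} → MaxDegAtMost G S k → j ≤ ∣ S ∣ → ∃ (SparseSet G k j)
  sparseSet-⊆ {S} maxDeg j≤∣S∣ =
    let T , T⊆S , ∣T∣≡j = ⊆-ofSize S j≤∣S∣ in T , ∣T∣≡j , maxDeg-antimono-⊆ T⊆S maxDeg

  maxDeg-∪-independent : ∀ {J X k} → IsIndependent G J → ∣ X ∣ ≤ k →
                         (∀ {x} → x ∈ X → degIn G J x + ∣ X ∣ ≤ suc k) →
                         MaxDegAtMost G (X ∪ J) k
  maxDeg-∪-independent {J} {X} {k} independent ∣X∣≤k light v v∈X∪J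
    with x∈p∪q⁻ X J v∈X∪J
  ... | inj₂ v∈J = begin
    degIn G (X ∪ J) v         ≤⟨ degIn-∪ X J v ⟩
    degIn G X v + degIn G J v ≡⟨ cong (degIn G X v +_) (degIn-independent independent v∈J) ⟩
    degIn G X v + 0           ≡⟨ +-identityʳ _ ⟩
    degIn G X v               ≤⟨ ∣p∩q∣≤∣p∣ X (N G v) ⟩
    ∣ X ∣                     ≤⟨ ∣X∣≤k ⟩
    k                         ∎
    where open ≤-Reasoning
  ... | inj₁ v∈X = ≤-pred (begin-strict
    degIn G (X ∪ J) v         ≤⟨ degIn-∪ X J v ⟩
    degIn G X v + degIn G J v <⟨ +-monoˡ-< (degIn G J v) (degIn-< v∈X) ⟩
    ∣ X ∣ + degIn G J v       ≡⟨ +-comm ∣ X ∣ _ ⟩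
    degIn G J v + ∣ X ∣       ≤⟨ light v∈X ⟩
    suc k                     ∎)
    where open ≤-Reasoning

-- Complements and split partitions

complement-involutive : ∀ (G : Graph n) u v → adj (complement (complement G)) u v ≡ adj G u v
complement-involutive G u v with u ≟ v
... | yes refl = sym (irrefl G u)
... | no _     = not-involutive (adj G u v)

sparseSet-complement-involutive : ∀ {G : Graph n} {k j S} →
  SparseSet (complement (complement G)) k j S → SparseSet G k j S
sparseSet-complement-involutive {G = G} {S = S} (∣S∣≡j , maxDeg) = ∣S∣≡j , λ v v∈S →
  subst (_≤ _) (cong (λ N → ∣ S ∩ N ∣) (tabulate-cong (complement-involutive G v))) (maxDeg v v∈S)

independent⇒complement-clique : ∀ {G : Graph n} {S} → IsIndependent G S → IsClique (complement G) S
independent⇒complement-clique {G = G} independent u v u∈S v∈S u≢v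
  rewrite dec-false (u ≟ v) u≢v | independent u v u∈S v∈S = refl

clique⇒complement-independent : ∀ {G : Graph n} {S} → IsClique G S → IsIndependent (complement G) S
clique⇒complement-independent {G = G} clique u v u∈S v∈S with u ≟ v
... | yes _   = refl
... | no u≢v rewrite clique u v u∈S v∈S u≢v = refl

record SplitPartition (G : Graph n) : Set where
  field
    clique        : Subset n
    independent   : Subset n
    isClique      : IsClique G clique
    isIndependent : IsIndependent G independent
    disjoint      : ∀ {v} → v ∈ clique → v ∉ independent

cliqueSize independentSize : ∀ {G : Graph n} → SplitPartition G → ℕ
cliqueSize      P = ∣ SplitPartition.clique P ∣
independentSize P = ∣ SplitPartition.independent P ∣

splitPartition : ∀ {G : Graph n} → IsSplit G → SplitPartition G
splitPartition (C , isClique , isIndependent) = record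
  { clique = C ; independent = ∁ C ; isClique = isClique ; isIndependent = isIndependent
  ; disjoint = x∈p⇒x∉∁p }

complementPartition : ∀ {G : Graph n} → SplitPartition G → SplitPartition (complement G)
complementPartition {G = G} P = record
  { clique        = independent
  ; independent   = clique
  ; isClique      = independent⇒complement-clique {G = G} isIndependent
  ; isIndependent = clique⇒complement-independent {G = G} isClique
  ; disjoint      = λ v∈J v∈K → disjoint v∈K v∈J }
  where open SplitPartition P

module Extensions {G : Graph n} (P : SplitPartition G) where
  open SplitPartition P

  sparse-independent : ∀ {k j} → j ≤ ∣ independent ∣ → ∃ (SparseSet G k j)
  sparse-independent {k} = sparseSet-⊆ G λ v v∈J →
    subst (_≤ k) (sym (degIn-independent G isIndependent v∈J)) z≤n

  sparse-extension : ∀ {k j} X → X ⊆ clique → ∣ X ∣ ≤ k →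
                     (∀ {x} → x ∈ X → degIn G independent x + ∣ X ∣ ≤ suc k) →
                     j ≤ ∣ X ∣ + ∣ independent ∣ → ∃ (SparseSet G k j)
  sparse-extension X X⊆K ∣X∣≤k light j≤ =
    sparseSet-⊆ G (maxDeg-∪-independent G isIndependent ∣X∣≤k light)
      (≤-trans j≤ (≤-reflexive (sym (∣p∪q∣≡∣p∣+∣q∣ X independent (disjoint ∘ X⊆K)))))

  sparse-independent+1 : ∀ {k j x} → 1 ≤ k → x ∈ clique → degIn G independent x ≤ k →
                         j ≤ suc ∣ independent ∣ → ∃ (SparseSet G k j)
  sparse-independent+1 {k} {j} {x} 1≤k x∈K light j≤ =
    sparse-extension ⁅ x ⁆ ⁅x⁆⊆K (subst (_≤ k) (sym (∣⁅x⁆∣≡1 x)) 1≤k) light′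
      (subst (λ s → j ≤ s + _) (sym (∣⁅x⁆∣≡1 x)) j≤)
    where
    ⁅x⁆⊆K : ⁅ x ⁆ ⊆ clique
    ⁅x⁆⊆K y∈ = subst (_∈ clique) (sym (x∈⁅y⁆⇒x≡y x y∈)) x∈K
    light′ : ∀ {y} → y ∈ ⁅ x ⁆ → degIn G independent y + ∣ ⁅ x ⁆ ∣ ≤ suc k
    light′ y∈ rewrite x∈⁅y⁆⇒x≡y x y∈ | ∣⁅x⁆∣≡1 x = subst (_≤ suc k) (+-comm 1 _) (s≤s light)

  sparse-independent+2 : ∀ {k j x y} → 2 ≤ k → x ≢ y → x ∈ clique → y ∈ clique →
                         degIn G independent x < k → degIn G independent y < k →
                         j ≤ 2 + ∣ independent ∣ → ∃ (SparseSet G k j)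
  sparse-independent+2 {k} {j} {x} {y} 2≤k x≢y x∈K y∈K lightx lighty j≤ =
    sparse-extension X X⊆K (subst (_≤ k) (sym ∣X∣≡2) 2≤k) light′
      (subst (λ s → j ≤ s + _) (sym ∣X∣≡2) j≤)
    where
    X = ⁅ x ⁆ ∪ ⁅ y ⁆
    ∣X∣≡2 : ∣ X ∣ ≡ 2
    ∣X∣≡2 = trans (∣p∪q∣≡∣p∣+∣q∣ ⁅ x ⁆ ⁅ y ⁆ λ z∈⁅x⁆ z∈⁅y⁆ →
                     x≢y (trans (sym (x∈⁅y⁆⇒x≡y x z∈⁅x⁆)) (x∈⁅y⁆⇒x≡y y z∈⁅y⁆)))
                  (cong₂ _+_ (∣⁅x⁆∣≡1 x) (∣⁅x⁆∣≡1 y))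
    X⊆K : X ⊆ clique
    X⊆K z∈ with x∈p∪q⁻ ⁅ x ⁆ ⁅ y ⁆ z∈
    ... | inj₁ z∈⁅x⁆ = subst (_∈ clique) (sym (x∈⁅y⁆⇒x≡y x z∈⁅x⁆)) x∈K
    ... | inj₂ z∈⁅y⁆ = subst (_∈ clique) (sym (x∈⁅y⁆⇒x≡y y z∈⁅y⁆)) y∈K
    light′ : ∀ {z} → z ∈ X → degIn G independent z + ∣ X ∣ ≤ suc k
    light′ z∈ rewrite ∣X∣≡2 with x∈p∪q⁻ ⁅ x ⁆ ⁅ y ⁆ z∈
    ... | inj₁ z∈⁅x⁆ rewrite x∈⁅y⁆⇒x≡y x z∈⁅x⁆ = subst (_≤ suc k) (+-comm 2 _) (s≤s lightx)
    ... | inj₂ z∈⁅y⁆ rewrite x∈⁅y⁆⇒x≡y y z∈⁅y⁆ = subst (_≤ suc k) (+-comm 2 _) (s≤s lighty)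

module Dichotomies {G : Graph n} (P : SplitPartition G) where
  open SplitPartition P
  open Extensions P
  private
    module Co = Extensions (complementPartition P)
    a = cliqueSize P
    b = independentSize P

  edges-≥ : ∀ {c} → (∀ {x} → x ∈ clique → c ≤ degIn G independent x) →
            c * a ≤ ∑ independent (degIn G clique)
  edges-≥ heavy = ≤-trans (const-≤-∑ clique heavy) (≤-reflexive (∑-degIn-comm G clique independent))

  degIn-clique-≤ : ∀ {v c} → v ∈ independent → c ≤ degIn (complement G) clique v →
                   degIn G clique v ≤ a ∸ c
  degIn-clique-≤ v∈J c≤ = m+n≤o⇒m≤o∸n _ (≤-trans (+-monoʳ-≤ _ c≤)
    (≤-reflexive (degIn+degIn-complement G (λ v∈K → disjoint v∈K v∈J))))

  dense₁⊎sparse₁ : ∀ {k i j} → 1 ≤ k → i ≤ suc a → j ≤ suc b → (a ∸ suc k) * b < suc k * a →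
                   ∃ (DenseSet G k i) ⊎ ∃ (SparseSet G k j)
  dense₁⊎sparse₁ {k} 1≤k i≤ j≤ few-edges
    with any? (λ x → x ∈? clique ×-dec degIn G independent x ≤? k)
  ... | yes (x , x∈K , light) = inj₂ (sparse-independent+1 1≤k x∈K light j≤)
  ... | no ¬light with any? (λ v → v ∈? independent ×-dec degIn (complement G) clique v ≤? k)
  ...   | yes (v , v∈J , light) = inj₁ (Co.sparse-independent+1 1≤k v∈J light i≤)
  ...   | no ¬colight = contradiction (begin
    suc k * a                          ≤⟨ edges-≥ (λ x∈K → ≰⇒> λ light → ¬light (_ , x∈K , light)) ⟩
    ∑ independent (degIn G clique)
      ≤⟨ ∑-≤-const independent (λ v∈J →
           degIn-clique-≤ v∈J (≰⇒> λ light → ¬colight (_ , v∈J , light))) ⟩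
    (a ∸ suc k) * b                    ∎) (<⇒≱ few-edges)
    where open ≤-Reasoning

  dense₂⊎sparse₁ : ∀ {k i j} → 2 ≤ k → i ≤ 2 + a → j ≤ suc b → (a ∸ k) * b + k < suc k * a →
                   ∃ (DenseSet G k i) ⊎ ∃ (SparseSet G k j)
  dense₂⊎sparse₁ {k} 2≤k i≤ j≤ few-edges
    with any? (λ x → x ∈? clique ×-dec degIn G independent x ≤? k)
  ... | yes (x , x∈K , light) = inj₂ (sparse-independent+1 (<⇒≤ 2≤k) x∈K light j≤)
  ... | no ¬light with any? (λ v → any? (λ w → ¬? (v ≟ w)
                     ×-dec (v ∈? independent ×-dec degIn (complement G) clique v <? k)
                     ×-dec (w ∈? independent ×-dec degIn (complement G) clique w <? k)))
  ...   | yes (v , w , v≢w , (v∈J , lightv) , (w∈J , lightw)) =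
            inj₁ (Co.sparse-independent+2 2≤k v≢w v∈J w∈J lightv lightw i≤)
  ...   | no ¬lightPair = contradiction (begin
    suc k * a                          ≤⟨ edges-≥ (λ x∈K → ≰⇒> λ light → ¬light (_ , x∈K , light)) ⟩
    ∑ independent (degIn G clique)     ≤⟨ ∑-≤-but-one independent heavy-but-one bounded ⟩
    (a ∸ k) * b + k                    ∎) (<⇒≱ few-edges)
    where
    open ≤-Reasoning
    heavy-but-one : AtMostOneAbove independent (degIn G clique) (a ∸ k)
    heavy-but-one {v} {w} v∈J w∈J v≢w
      with degIn (complement G) clique v <? k | degIn (complement G) clique w <? k
    ... | no ¬lightv | _           = inj₁ (degIn-clique-≤ v∈J (≮⇒≥ ¬lightv))
    ... | yes _      | no ¬lightw  = inj₂ (degIn-clique-≤ w∈J (≮⇒≥ ¬lightw))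
    ... | yes lightv | yes lightw  =
      contradiction (v , w , v≢w , (v∈J , lightv) , (w∈J , lightw)) ¬lightPair
    bounded : ∀ {v} → v ∈ independent → degIn G clique v ≤ a ∸ k + k
    bounded _ = ≤-trans (∣p∩q∣≤∣p∣ clique _) (≤-trans (m≤n+m∸n a k) (≤-reflexive (+-comm k _)))

-- Upper bounds

+-tight : ∀ {a b A B} → a ≤ A → b ≤ B → a + b ≡ A + B → a ≡ A × b ≡ B
+-tight {a} {b} {A} {B} a≤A b≤B a+b≡A+B =
  a≡A , +-cancelˡ-≡ A b B (trans (cong (_+ b) (sym a≡A)) a+b≡A+B)
  where
  a≡A : a ≡ A
  a≡A = ≤-antisym a≤A (+-cancelʳ-≤ B A a (≤-trans (≤-reflexive (sym a+b≡A+B)) (+-monoʳ-≤ a b≤B)))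

+-tight-suc : ∀ {a b A B} → a ≤ suc A → b ≤ suc B → a + b ≡ suc (A + B) →
              (a ≡ A × b ≡ suc B) ⊎ (a ≡ suc A × b ≡ B)
+-tight-suc {a} {b} {A} {B} a≤1+A b≤1+B a+b≡ with a ≤? A
... | yes a≤A = inj₁ (+-tight a≤A b≤1+B (trans a+b≡ (sym (+-suc A B))))
... | no a≰A  = inj₂ (a≡1+A , +-cancelˡ-≡ (suc A) b B (trans (cong (_+ b) (sym a≡1+A)) a+b≡))
  where
  a≡1+A : a ≡ suc A
  a≡1+A = ≤-antisym a≤1+A (≰⇒> a≰A)

splitRamsey-byPartition : ∀ {k i j n} →
  (∀ {G : Graph n} (P : SplitPartition G) → cliqueSize P + independentSize P ≡ n →
     cliqueSize P < i → independentSize P < j → ∃ (DenseSet G k i) ⊎ ∃ (SparseSet G k j)) →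
  SplitRamseyProp k i j n
splitRamsey-byPartition {k} {i} {j} unbalanced G split@(C , _) = byCases
  where
  P : SplitPartition G
  P = splitPartition split
  byCases : ∃ (DenseSet G k i) ⊎ ∃ (SparseSet G k j)
  byCases with i ≤? ∣ C ∣ | j ≤? ∣ ∁ C ∣
  ... | yes i≤a | _       = inj₁ (Extensions.sparse-independent (complementPartition P) i≤a)
  ... | no _    | yes j≤b = inj₂ (Extensions.sparse-independent P j≤b)
  ... | no i≰a  | no j≰b  = unbalanced P (∣p∣+∣∁p∣≡n C) (≰⇒> i≰a) (≰⇒> j≰b)

splitRamsey-+1+1 : ∀ {k A B} → 1 ≤ k → (A ∸ suc k) * B < suc k * A →
                   SplitRamseyProp k (suc A) (suc B) (A + B)
splitRamsey-+1+1 {k} 1≤k few-edges = splitRamsey-byPartition λ P a+b≡A+B a<1+A b<1+B →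
  let a≡A , b≡B = +-tight (≤-pred a<1+A) (≤-pred b<1+B) a+b≡A+B in
  Dichotomies.dense₁⊎sparse₁ P 1≤k (s≤s (≤-reflexive (sym a≡A))) (s≤s (≤-reflexive (sym b≡B)))
    (subst₂ (λ a b → (a ∸ suc k) * b < suc k * a) (sym a≡A) (sym b≡B) few-edges)

-- Parts of sizes (A, 1 + B) are handled in G, and parts of sizes (1 + A, B) in its
-- complement, where the roles of clique and independent set are exchanged.
splitRamsey-+2+2 : ∀ {k A B} → 2 ≤ k →
                   (A ∸ k) * suc B + k < suc k * A → (B ∸ k) * suc A + k < suc k * B →
                   SplitRamseyProp k (2 + A) (2 + B) (suc (A + B))
splitRamsey-+2+2 {k} {A} {B} 2≤k few-edges few-coedges = splitRamsey-byPartition unbalanced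
  where
  unbalanced : ∀ {G : Graph (suc (A + B))} (P : SplitPartition G) →
               cliqueSize P + independentSize P ≡ suc (A + B) →
               cliqueSize P < 2 + A → independentSize P < 2 + B →
               ∃ (DenseSet G k (2 + A)) ⊎ ∃ (SparseSet G k (2 + B))
  unbalanced {G} P a+b≡ a<2+A b<2+B with +-tight-suc (≤-pred a<2+A) (≤-pred b<2+B) a+b≡
  ... | inj₁ (a≡A , b≡1+B) =
    Dichotomies.dense₂⊎sparse₁ P 2≤k
      (s≤s (s≤s (≤-reflexive (sym a≡A)))) (s≤s (≤-reflexive (sym b≡1+B)))
      (subst₂ (λ a b → (a ∸ k) * b + k < suc k * a) (sym a≡A) (sym b≡1+B) few-edges)
  ... | inj₂ (a≡1+A , b≡B) = swap (map₁ (map₂ (sparseSet-complement-involutive {G = G}))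
    (Dichotomies.dense₂⊎sparse₁ (complementPartition P) 2≤k
      (s≤s (s≤s (≤-reflexive (sym b≡B)))) (s≤s (≤-reflexive (sym a≡1+A)))
      (subst₂ (λ b a → (b ∸ k) * a + k < suc k * b) (sym b≡B) (sym a≡1+A) few-coedges)))

-- Lower bounds

deleteZero : Graph (suc n) → Graph n
deleteZero G = record
  { adj    = λ u v → adj G (suc u) (suc v)
  ; sym    = λ u v → Graph.sym G (suc u) (suc v)
  ; irrefl = irrefl G ∘ suc }

deleteZero-isSplit : ∀ {G : Graph (suc n)} → IsSplit G → IsSplit (deleteZero G)
deleteZero-isSplit (_ ∷ C , isClique , isIndependent) =
  C , (λ u v u∈C v∈C u≢v → isClique (suc u) (suc v) (there u∈C) (there v∈C) (u≢v ∘ suc-injective))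
    , (λ u v u∈∁C v∈∁C → isIndependent (suc u) (suc v) (there u∈∁C) (there v∈∁C))

sparseSet-deleteZero : ∀ {G : Graph (suc n)} {k j S} →
                       SparseSet (deleteZero G) k j S → SparseSet G k j (outside ∷ S)
sparseSet-deleteZero (∣S∣≡j , maxDeg) = ∣S∣≡j , λ { (suc v) (there v∈S) → maxDeg v v∈S }

-- complement (deleteZero G) and deleteZero (complement G) have definitionally equal adjacency.
splitRamsey-suc : ∀ {k i j} → SplitRamseyProp k i j m → SplitRamseyProp k i j (suc m)
splitRamsey-suc holds G split with holds (deleteZero G) (deleteZero-isSplit {G = G} split)
... | inj₁ (S , dense)  = inj₁ (outside ∷ S , sparseSet-deleteZero {G = complement G} dense)
... | inj₂ (S , sparse) = inj₂ (outside ∷ S , sparseSet-deleteZero {G = G} sparse)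

splitRamsey-mono : ∀ {k i j} → m ≤ n → SplitRamseyProp k i j m → SplitRamseyProp k i j n
splitRamsey-mono m≤n = go (≤⇒≤′ m≤n)
  where
  go : ∀ {k i j m n} → m ≤′ n → SplitRamseyProp k i j m → SplitRamseyProp k i j n
  go ≤′-refl        holds = holds
  go (≤′-step m≤′n) holds = splitRamsey-suc (go m≤′n holds)

sparseSet? : ∀ (G : Graph n) k j → Decidable (SparseSet G k j)
sparseSet? G k j S = ∣ S ∣ ≟ℕ j ×-dec all? (λ v → v ∈? S →-dec degIn G S v ≤? k)

splitRamsey-lower : ∀ {k i j} (G : Graph n) → IsSplit G →
                    ¬ ∃ (DenseSet G k i) → ¬ ∃ (SparseSet G k j) →
                    ∀ m → SplitRamseyProp k i j m → n < m
splitRamsey-lower {n} G split noDense noSparse m holds with n <? m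
... | yes n<m = n<m
... | no n≮m  = ⊥-elim ([ noDense , noSparse ]′ (splitRamsey-mono (≮⇒≥ n≮m) holds G split))

module _ {a b : ℕ} (R : Fin a → Fin b → Bool) where

  splitAdj : Fin a ⊎ Fin b → Fin a ⊎ Fin b → Bool
  splitAdj (inj₁ x) (inj₁ y) = not (does (x ≟ y))
  splitAdj (inj₁ x) (inj₂ w) = R x w
  splitAdj (inj₂ w) (inj₁ x) = R x w
  splitAdj (inj₂ _) (inj₂ _) = false

  splitAdj-sym : ∀ p q → splitAdj p q ≡ splitAdj q p
  splitAdj-sym (inj₁ x) (inj₁ y) with x ≟ y | y ≟ x
  ... | yes _   | yes _   = refl
  ... | no _    | no _    = refl
  ... | yes x≡y | no y≢x  = contradiction (sym x≡y) y≢x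
  ... | no x≢y  | yes y≡x = contradiction (sym y≡x) x≢y
  splitAdj-sym (inj₁ _) (inj₂ _) = refl
  splitAdj-sym (inj₂ _) (inj₁ _) = refl
  splitAdj-sym (inj₂ _) (inj₂ _) = refl

  splitAdj-irrefl : ∀ p → splitAdj p p ≡ false
  splitAdj-irrefl (inj₁ x) = cong not (dec-true (x ≟ x) refl)
  splitAdj-irrefl (inj₂ _) = refl

  splitGraph : Graph (a + b)
  splitGraph = record
    { adj    = λ u v → splitAdj (splitAt a u) (splitAt a v)
    ; sym    = λ u v → splitAdj-sym (splitAt a u) (splitAt a v)
    ; irrefl = λ v → splitAdj-irrefl (splitAt a v) }

  splitGraph-isSplit : IsSplit splitGraph
  splitGraph-isSplit = tabulate (inClique ∘ splitAt a) , isClique , isIndependent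
    where
    inClique : Fin a ⊎ Fin b → Bool
    inClique (inj₁ _) = true
    inClique (inj₂ _) = false
    isClique : IsClique splitGraph (tabulate (inClique ∘ splitAt a))
    isClique u v u∈ v∈ u≢v
      with splitAt a u in eu | splitAt a v in ev | ∈-tabulate⁻ u∈ | ∈-tabulate⁻ v∈
    ... | inj₁ x | inj₁ y | _ | _ =
      cong not (dec-false (x ≟ y) λ { refl →
        u≢v (trans (sym (splitAt⁻¹-↑ˡ eu)) (splitAt⁻¹-↑ˡ ev)) })
    ... | inj₂ _ | _ | () | _
    ... | inj₁ _ | inj₂ _ | _ | ()
    isIndependent : IsIndependent splitGraph (∁ (tabulate (inClique ∘ splitAt a)))
    isIndependent u v u∈ v∈ with splitAt a u | splitAt a v | ∈-∁-tabulate⁻ u∈ | ∈-∁-tabulate⁻ v∈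
    ... | inj₂ _ | inj₂ _ | _ | _ = refl
    ... | inj₁ _ | _ | () | _
    ... | inj₂ _ | inj₁ _ | _ | ()

fromNeighbours : ∀ {a b} → Vec (List (Fin b)) a → Fin a → Fin b → Bool
fromNeighbours neighbours x w = any (does ∘ (w ≟_)) (lookup neighbours x)

splitGraph-lower : ∀ {a b k i j} (R : Fin a → Fin b → Bool) →
  {_ : False (anySubset? (sparseSet? (complement (splitGraph R)) k i))} →
  {_ : False (anySubset? (sparseSet? (splitGraph R) k j))} →
  ∀ m → SplitRamseyProp k i j m → a + b < m
splitGraph-lower R {noDense} {noSparse} =
  splitRamsey-lower (splitGraph R) (splitGraph-isSplit R)
    (toWitnessFalse noDense) (toWitnessFalse noSparse)

R₁[4,5]≡7 : SplitRamseyIs 1 4 5 7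
R₁[4,5]≡7 = splitRamsey-+1+1 (s≤s z≤n) (≤ᵇ⇒≤ _ _ tt)
          , splitGraph-lower {b = 4} (fromNeighbours ( (# 1 ∷ # 2 ∷ # 3 ∷ [])
                                                     ∷ (# 0 ∷ # 3 ∷ []) ∷ []))

R₁[4,6]≡8 : SplitRamseyIs 1 4 6 8
R₁[4,6]≡8 = splitRamsey-+1+1 (s≤s z≤n) (≤ᵇ⇒≤ _ _ tt)
          , splitGraph-lower {b = 5} (fromNeighbours ( (# 0 ∷ # 4 ∷ [])
                                                     ∷ (# 2 ∷ # 4 ∷ []) ∷ []))

R₂[6,7]≡11 : SplitRamseyIs 2 6 7 11
R₂[6,7]≡11 = splitRamsey-+1+1 (s≤s z≤n) (≤ᵇ⇒≤ _ _ tt)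
           , splitGraph-lower {b = 6} (fromNeighbours ( (# 1 ∷ # 2 ∷ # 3 ∷ [])
                                                      ∷ (# 2 ∷ # 4 ∷ # 5 ∷ [])
                                                      ∷ (# 0 ∷ # 3 ∷ # 4 ∷ # 5 ∷ [])
                                                      ∷ (# 0 ∷ # 1 ∷ # 3 ∷ []) ∷ []))

R₂[6,8]≡12 : SplitRamseyIs 2 6 8 12
R₂[6,8]≡12 = splitRamsey-+1+1 (s≤s z≤n) (≤ᵇ⇒≤ _ _ tt)
           , splitGraph-lower {b = 7} (fromNeighbours ( (# 4 ∷ # 5 ∷ # 6 ∷ [])
                                                      ∷ (# 0 ∷ # 2 ∷ # 3 ∷ [])
                                                      ∷ (# 1 ∷ # 2 ∷ # 5 ∷ [])
                                                      ∷ (# 0 ∷ # 3 ∷ # 4 ∷ []) ∷ []))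

R₂[5,6]≡8 : SplitRamseyIs 2 5 6 8
R₂[5,6]≡8 = splitRamsey-+2+2 (s≤s (s≤s z≤n)) (≤ᵇ⇒≤ _ _ tt) (≤ᵇ⇒≤ _ _ tt)
          , splitGraph-lower {b = 5} (fromNeighbours ( (# 0 ∷ # 1 ∷ # 3 ∷ # 4 ∷ [])
                                                     ∷ (# 0 ∷ # 1 ∷ # 2 ∷ []) ∷ []))

R₂[5,7]≡9 : SplitRamseyIs 2 5 7 9
R₂[5,7]≡9 = splitRamsey-+2+2 (s≤s (s≤s z≤n)) (≤ᵇ⇒≤ _ _ tt) (≤ᵇ⇒≤ _ _ tt)
          , splitGraph-lower {b = 6} (fromNeighbours ( (# 0 ∷ # 4 ∷ # 5 ∷ [])
                                                     ∷ (# 1 ∷ # 2 ∷ # 3 ∷ # 4 ∷ # 5 ∷ []) ∷ []))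

R₂[5,j]≡j+3 : ∀ j → 8 ≤ j → j ≤ 12 → SplitRamseyIs 2 5 j (j + 3)
R₂[5,j]≡j+3 j 8≤j j≤12 with m≤n⇒∃[o]m+o≡n 8≤j
... | 0 , refl = splitRamsey-+1+1 (s≤s z≤n) (≤ᵇ⇒≤ _ _ tt)
               , splitGraph-lower {b = 7} (fromNeighbours ( (# 0 ∷ # 1 ∷ # 6 ∷ [])
                                                          ∷ (# 2 ∷ # 3 ∷ # 6 ∷ [])
                                                          ∷ (# 4 ∷ # 5 ∷ # 6 ∷ []) ∷ []))
... | 1 , refl = splitRamsey-+1+1 (s≤s z≤n) (≤ᵇ⇒≤ _ _ tt)
               , splitGraph-lower {b = 8} (fromNeighbours ( (# 1 ∷ # 2 ∷ # 7 ∷ [])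
                                                          ∷ (# 3 ∷ # 4 ∷ # 7 ∷ [])
                                                          ∷ (# 5 ∷ # 6 ∷ # 7 ∷ []) ∷ []))
... | 2 , refl = splitRamsey-+1+1 (s≤s z≤n) (≤ᵇ⇒≤ _ _ tt)
               , splitGraph-lower {b = 9} (fromNeighbours ( (# 4 ∷ # 5 ∷ # 8 ∷ [])
                                                          ∷ (# 0 ∷ # 1 ∷ # 3 ∷ [])
                                                          ∷ (# 4 ∷ # 6 ∷ # 7 ∷ []) ∷ []))
... | 3 , refl = splitRamsey-+1+1 (s≤s z≤n) (≤ᵇ⇒≤ _ _ tt)
               , splitGraph-lower {b = 10} (fromNeighbours ( (# 0 ∷ # 5 ∷ # 9 ∷ [])
                                                           ∷ (# 6 ∷ # 8 ∷ # 9 ∷ [])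
                                                           ∷ (# 1 ∷ # 2 ∷ # 7 ∷ # 9 ∷ []) ∷ []))
... | 4 , refl = splitRamsey-+1+1 (s≤s z≤n) (≤ᵇ⇒≤ _ _ tt)
               , splitGraph-lower {b = 11} (fromNeighbours ( (# 2 ∷ # 4 ∷ # 6 ∷ [])
                                                           ∷ (# 0 ∷ # 7 ∷ # 8 ∷ [])
                                                           ∷ (# 0 ∷ # 1 ∷ # 3 ∷ # 5 ∷ []) ∷ []))
... | suc (suc (suc (suc (suc _)))) , refl = contradiction (m+n≤o⇒m≤o 13 j≤12) (n≮n 12)

theorem6p4 : (SplitRamseyIs 1 4 5 7 × SplitRamseyIs 1 4 6 8)
    × (SplitRamseyIs 2 6 7 11 × SplitRamseyIs 2 6 8 12)
    × (SplitRamseyIs 2 5 6 8 × SplitRamseyIs 2 5 7 9)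
    × (∀ (j : ℕ) → 8 ≤ j → j ≤ 12 → SplitRamseyIs 2 5 j (j + 3))
theorem6p4 = (R₁[4,5]≡7 , R₁[4,6]≡8) , (R₂[6,7]≡11 , R₂[6,8]≡12) , (R₂[5,6]≡8 , R₂[5,7]≡9)
           , R₂[5,j]≡j+3
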